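{- For every integer $k\in\mathbb{Z}$ and every integer $n\ge 0$, \[ D_n^{(k-1)}=\sum_{m=0}^{\lfloor n/2\rfloor}\binom{n+1}{2m+1}D_{n-2m}^{(k)}. \]
   Context: For $k\in\mathbb{Z}$ let $\mathrm{A}_k(z)=2\sum_{n=0}^\infty \frac{z^{2n+1}}{(2n+1)^k}$, regarded as a formal power series in $z$. The poly-cosecant numbers $D_n^{(k)}\in\mathbb{Q}$ ($n\ge 0$) are defined by the formal power series identity \[ \frac{\mathrm{A}_k(\tanh(t/2))}{\sinh t}=\sum_{n=0}^\infty D_n^{(k)}\frac{t^n}{n!}. \] -}

module Defs where

open import Data.Nat as ℕ using (ℕ; zero; suc; _∸_; _!; _^_)
open import Data.Nat.Properties using (m^n≢0; _!≢0)
open import Data.Integer as ℤ using (ℤ; +_; -[1+_])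
open import Data.Rational using (ℚ; 0ℚ; 1ℚ; _+_; _*_; _-_; _/_)
open import Data.List using (List; []; _∷_; foldr; map; zipWith; upTo; length)

-- Formal power series over ℚ, as coefficient sequences: f ↦ Σ f n tⁿ.

Series : Set
Series = ℕ → ℚ

Σ≤ : ℕ → (ℕ → ℚ) → ℚ
Σ≤ n f = foldr _+_ 0ℚ (map f (upTo (suc n)))

ℕ→ℚ : ℕ → ℚ
ℕ→ℚ n = (+ n) / 1

inv! : ℕ → ℚ
inv! n = (+ 1) / (n !)
  where instance _ = n !≢0

half^ : ℕ → ℚ
half^ n = (+ 1) / (2 ^ n)
  where instance _ = m^n≢0 2 n

_·_ : Series → Series → Series
(f · g) n = Σ≤ n (λ i → f i * g (n ∸ i))

one : Series
one zero    = 1ℚ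
one (suc _) = 0ℚ

pow : Series → ℕ → Series
pow f zero    = one
pow f (suc j) = f · pow f j

-- Composition f(g) for g with zero constant term:
-- [tⁿ] f(g) = Σ_{j=0}^{n} f_j [tⁿ] g^j   (exact since ord g^j ≥ j).
compose : Series → Series → Series
compose f g n = Σ≤ n (λ j → f j * pow g j n)

-- Quotient g / s for s with constant term 1: the unique q with s·q = g,
-- computed by q_n = g_n - Σ_{i=1}^{n} s_i q_{n-i}.
-- revQuot g s n = q_n ∷ q_{n-1} ∷ … ∷ q_0
revQuot : Series → Series → ℕ → List ℚ
revQuot g s zero    = g zero ∷ []
revQuot g s (suc n) =
  let r = revQuot g s n in
  (g (suc n) - foldr _+_ 0ℚ (zipWith (λ j q → s (suc j) * q) (upTo (length r)) r)) ∷ r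

headOr0 : List ℚ → ℚ
headOr0 []      = 0ℚ
headOr0 (x ∷ _) = x

_÷ₛ_ : Series → Series → Series
(g ÷ₛ s) n = headOr0 (revQuot g s n)

-- shift: (f / t) when f has zero constant term
shift : Series → Series
shift f n = f (suc n)

odd? : ℕ → ℚ
odd? zero          = 0ℚ
odd? (suc zero)    = 1ℚ
odd? (suc (suc n)) = odd? n

even? : ℕ → ℚ
even? n = odd? (suc n)

sinh : Series
sinh n = odd? n * inv! n

sinhHalf coshHalf : Series
sinhHalf n = odd?  n * half^ n * inv! n
coshHalf n = even? n * half^ n * inv! n

tanhHalf : Series
tanhHalf = sinhHalf ÷ₛ coshHalf

invPowZ : (m : ℕ) → .{{_ : ℕ.NonZero m}} → ℤ → ℚ
invPowZ m (+ n)     = (+ 1) / (m ^ n)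
  where instance _ = m^n≢0 m n
invPowZ m -[1+ n ]  = ℕ→ℚ (m ^ suc n)

-- A_k(z) = 2 Σ_{n≥0} z^{2n+1} / (2n+1)^k
A : ℤ → Series
A k zero    = 0ℚ
A k (suc m) = odd? (suc m) * ℕ→ℚ 2 * invPowZ (suc m) k

-- Poly-cosecant numbers:
--   A_k(tanh(t/2)) / sinh t = Σ_n D_n^{(k)} tⁿ/n!.
-- Since sinh t = t · (sinh t / t) and A_k(tanh(t/2)) has zero constant
-- term, the quotient is (A_k(tanh(t/2))/t) ÷ (sinh t / t), the latter
-- having constant term 1.

polyCosecantSeries : ℤ → Series
polyCosecantSeries k = shift (compose (A k) tanhHalf) ÷ₛ shift sinh

D : ℤ → ℕ → ℚ
D k n = ℕ→ℚ (n !) * polyCosecantSeries k n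

{-# OPTIONS --safe #-}
module Submission where

open import Defs

-- Write F_k for the series with coefficients D_n^(k)/n!, so that sinh t · F_k = A_k(z) with
-- z = tanh(t/2). From sinh(t/2)' = cosh(t/2)/2, cosh(t/2)' = sinh(t/2)/2 and sinh t = 2 sinh(t/2) cosh(t/2)
-- one gets sinh t · z' = z, so the operator θ = sinh t · d/dt satisfies θ zʲ = j zʲ and hence
-- θ A_k(z) = A_(k-1)(z). Cancelling sinh t gives F_(k-1) = (sinh t · F_k)', and extracting the n-th
-- coefficient is a binomial convolution with the exponential coefficients of sinh t, which vanish at
-- even indices and are 1 at odd ones.

module _ where

  import Algebra.Properties.CommutativeSemigroup as CommutativeSemigroupProperties
  import Algebra.Properties.Group as GroupProperties
  import Algebra.Solver.Ring.NaturalCoefficients.Default as NaturalCoefficientSolver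
  open import Algebra.Bundles using (CommutativeRing; CommutativeMonoid)
  open import Data.List using (_∷_; foldr; applyUpTo; upTo; zipWith; length)
  open import Data.List.Properties using (map-upTo; length-applyUpTo)
  open import Data.Nat as ℕ using (ℕ; zero; suc; _∸_; _≤_; _<_; z≤n; s≤s; _!; _^_; ⌊_/2⌋; NonZero)
  import Data.Nat.Properties as ℕ
  open import Data.Nat.Combinatorics using (_C_; k![n∸k]!∣n!)
  open import Data.Nat.Combinatorics.Specification using (nCk≡n!/k![n-k]!)
  open import Data.Nat.DivMod using (m/n*n≡m)
  open import Data.Integer as ℤ using (1ℤ; -[1+_])
  import Data.Integer.Properties as ℤ
  open import Data.Product using (_×_; _,_; proj₁)
  open import Data.Rational using (ℚ; 0ℚ; 1ℚ; _+_; _*_; _-_; -_; _/_; fromℚᵘ)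
  import Data.Rational.Properties as ℚ
  open import Data.Rational.Solver using (module +-*-Solver)
  open import Data.Rational.Unnormalised as ℚᵘ using (mkℚᵘ; *≡*)
  import Data.Rational.Unnormalised.Properties as ℚᵘ
  open import Function using (_∘_)
  open import Level using (0ℓ)
  open import Relation.Binary.PropositionalEquality
  import Relation.Binary.Reasoning.Setoid as SetoidReasoning

  open CommutativeSemigroupProperties (CommutativeMonoid.commutativeSemigroup ℚ.*-1-commutativeMonoid)
    using (x∙yz≈y∙xz)
  open CommutativeSemigroupProperties (CommutativeMonoid.commutativeSemigroup ℚ.+-0-commutativeMonoid)
    using (interchange)
  open GroupProperties ℚ.+-0-group using () renaming (∙-cancelʳ to +-cancelʳ)

  -- Arithmetic of ℕ→ℚ and of unit fractions

  -- ℕ→ℚ n and 1ℤ / suc m are definitionally fromℚᵘ of unnormalised fractions, so their arithmetic is done in ℚᵘ.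

  fromℚᵘ-homo-+ : ∀ p q → fromℚᵘ (p ℚᵘ.+ q) ≡ fromℚᵘ p + fromℚᵘ q
  fromℚᵘ-homo-+ p q = ℚ.toℚᵘ-injective (ℚᵘ.≃-trans (ℚ.toℚᵘ-fromℚᵘ (p ℚᵘ.+ q)) (ℚᵘ.≃-sym
    (ℚᵘ.≃-trans (ℚ.toℚᵘ-homo-+ (fromℚᵘ p) (fromℚᵘ q)) (ℚᵘ.+-cong (ℚ.toℚᵘ-fromℚᵘ p) (ℚ.toℚᵘ-fromℚᵘ q)))))

  fromℚᵘ-homo-* : ∀ p q → fromℚᵘ (p ℚᵘ.* q) ≡ fromℚᵘ p * fromℚᵘ q
  fromℚᵘ-homo-* p q = ℚ.toℚᵘ-injective (ℚᵘ.≃-trans (ℚ.toℚᵘ-fromℚᵘ (p ℚᵘ.* q)) (ℚᵘ.≃-sym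
    (ℚᵘ.≃-trans (ℚ.toℚᵘ-homo-* (fromℚᵘ p) (fromℚᵘ q)) (ℚᵘ.*-cong (ℚ.toℚᵘ-fromℚᵘ p) (ℚ.toℚᵘ-fromℚᵘ q)))))

  ℕ→ℚ-homo-+ : ∀ m n → ℕ→ℚ (m ℕ.+ n) ≡ ℕ→ℚ m + ℕ→ℚ n
  ℕ→ℚ-homo-+ m n = trans
    (ℚ.fromℚᵘ-cong {mkℚᵘ (ℤ.+ (m ℕ.+ n)) 0} {mkℚᵘ (ℤ.+ m) 0 ℚᵘ.+ mkℚᵘ (ℤ.+ n) 0} (*≡* (cong (ℤ._* 1ℤ) eq)))
    (fromℚᵘ-homo-+ (mkℚᵘ (ℤ.+ m) 0) (mkℚᵘ (ℤ.+ n) 0))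
    where
    eq : ℤ.+ (m ℕ.+ n) ≡ ℤ.+ m ℤ.* 1ℤ ℤ.+ ℤ.+ n ℤ.* 1ℤ
    eq = trans (ℤ.pos-+ m n) (sym (cong₂ ℤ._+_ (ℤ.*-identityʳ (ℤ.+ m)) (ℤ.*-identityʳ (ℤ.+ n))))

  ℕ→ℚ-homo-* : ∀ m n → ℕ→ℚ (m ℕ.* n) ≡ ℕ→ℚ m * ℕ→ℚ n
  ℕ→ℚ-homo-* m n = trans
    (ℚ.fromℚᵘ-cong {mkℚᵘ (ℤ.+ (m ℕ.* n)) 0} {mkℚᵘ (ℤ.+ m) 0 ℚᵘ.* mkℚᵘ (ℤ.+ n) 0} (*≡* (cong (ℤ._* 1ℤ) (ℤ.pos-* m n))))
    (fromℚᵘ-homo-* (mkℚᵘ (ℤ.+ m) 0) (mkℚᵘ (ℤ.+ n) 0))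

  1/-homo-* : ∀ m n .{{_ : NonZero m}} .{{_ : NonZero n}} →
              (1ℤ / (m ℕ.* n)) {{ℕ.m*n≢0 m n}} ≡ (1ℤ / m) * (1ℤ / n)
  1/-homo-* (suc m) (suc n) = fromℚᵘ-homo-* (mkℚᵘ 1ℤ m) (mkℚᵘ 1ℤ n)

  ℕ→ℚ-*-inverse : ∀ n .{{_ : NonZero n}} → ℕ→ℚ n * (1ℤ / n) ≡ 1ℚ
  ℕ→ℚ-*-inverse (suc n) = trans (sym (fromℚᵘ-homo-* (mkℚᵘ (ℤ.+ suc n) 0) (mkℚᵘ 1ℤ n)))
    (ℚ.fromℚᵘ-cong {mkℚᵘ (ℤ.+ suc n) 0 ℚᵘ.* mkℚᵘ 1ℤ n} {mkℚᵘ 1ℤ 0} (*≡* eq))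
    where
    open ≡-Reasoning
    eq : (ℤ.+ suc n ℤ.* 1ℤ) ℤ.* 1ℤ ≡ 1ℤ ℤ.* ℤ.+ (1 ℕ.* suc n)
    eq = begin
      (ℤ.+ suc n ℤ.* 1ℤ) ℤ.* 1ℤ ≡⟨ ℤ.*-identityʳ _ ⟩
      ℤ.+ suc n ℤ.* 1ℤ          ≡⟨ ℤ.*-identityʳ _ ⟩
      ℤ.+ suc n                 ≡⟨ cong ℤ.+_ (ℕ.*-identityˡ (suc n)) ⟨
      ℤ.+ (1 ℕ.* suc n)         ≡⟨ ℤ.*-identityˡ _ ⟨
      1ℤ ℤ.* ℤ.+ (1 ℕ.* suc n)  ∎

  n*[1/n*x]≡x : ∀ n .{{_ : NonZero n}} x → ℕ→ℚ n * ((1ℤ / n) * x) ≡ x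
  n*[1/n*x]≡x n x = begin
    ℕ→ℚ n * ((1ℤ / n) * x)  ≡⟨ ℚ.*-assoc (ℕ→ℚ n) (1ℤ / n) x ⟨
    ℕ→ℚ n * (1ℤ / n) * x    ≡⟨ cong (_* x) (ℕ→ℚ-*-inverse n) ⟩
    1ℚ * x                  ≡⟨ ℚ.*-identityˡ x ⟩
    x                       ∎
    where open ≡-Reasoning

  *-cancelˡ-ℕ→ℚ : ∀ n .{{_ : NonZero n}} {x y} → ℕ→ℚ n * x ≡ ℕ→ℚ n * y → x ≡ y
  *-cancelˡ-ℕ→ℚ n {x} {y} eq = begin
    x                              ≡⟨ n*[1/n*x]≡x n x ⟨
    ℕ→ℚ n * ((1ℤ / n) * x)         ≡⟨ x∙yz≈y∙xz (ℕ→ℚ n) (1ℤ / n) x ⟩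
    (1ℤ / n) * (ℕ→ℚ n * x)         ≡⟨ cong ((1ℤ / n) *_) eq ⟩
    (1ℤ / n) * (ℕ→ℚ n * y)         ≡⟨ x∙yz≈y∙xz (1ℤ / n) (ℕ→ℚ n) y ⟩
    ℕ→ℚ n * ((1ℤ / n) * y)         ≡⟨ n*[1/n*x]≡x n y ⟩
    y                              ∎
    where open ≡-Reasoning

  inv!-suc : ∀ n → ℕ→ℚ (suc n) * inv! (suc n) ≡ inv! n
  inv!-suc n = trans (cong (ℕ→ℚ (suc n) *_) (1/-homo-* (suc n) (n !) {{_}} {{n ℕ.!≢0}})) (n*[1/n*x]≡x (suc n) (inv! n))

  half^-suc : ∀ n → half^ (suc n) ≡ half^ 1 * half^ n
  half^-suc n = 1/-homo-* 2 (2 ^ n) {{_}} {{ℕ.m^n≢0 2 n}}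

  -- Finite sums

  ∑ : ℕ → (ℕ → ℚ) → ℚ
  ∑ zero    f = 0ℚ
  ∑ (suc n) f = f 0 + ∑ n (f ∘ suc)

  foldr-+-applyUpTo : ∀ n (f : ℕ → ℚ) → foldr _+_ 0ℚ (applyUpTo f n) ≡ ∑ n f
  foldr-+-applyUpTo zero    f = refl
  foldr-+-applyUpTo (suc n) f = cong (f 0 +_) (foldr-+-applyUpTo n (f ∘ suc))

  Σ≤≡∑ : ∀ n f → Σ≤ n f ≡ ∑ (suc n) f
  Σ≤≡∑ n f = trans (cong (foldr _+_ 0ℚ) (map-upTo f (suc n))) (foldr-+-applyUpTo (suc n) f)

  ∑-cong : ∀ n {f g : ℕ → ℚ} → (∀ i → i < n → f i ≡ g i) → ∑ n f ≡ ∑ n g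
  ∑-cong zero    f≡g = refl
  ∑-cong (suc n) f≡g = cong₂ _+_ (f≡g 0 (s≤s z≤n)) (∑-cong n (λ i i<n → f≡g (suc i) (s≤s i<n)))

  ∑-zero : ∀ n {f : ℕ → ℚ} → (∀ i → i < n → f i ≡ 0ℚ) → ∑ n f ≡ 0ℚ
  ∑-zero zero    f≡0 = refl
  ∑-zero (suc n) f≡0 = cong₂ _+_ (f≡0 0 (s≤s z≤n)) (∑-zero n (λ i i<n → f≡0 (suc i) (s≤s i<n)))

  ∑-distrib-+ : ∀ n (f g : ℕ → ℚ) → ∑ n (λ i → f i + g i) ≡ ∑ n f + ∑ n g
  ∑-distrib-+ zero    f g = refl
  ∑-distrib-+ (suc n) f g =
    trans (cong (f 0 + g 0 +_) (∑-distrib-+ n (f ∘ suc) (g ∘ suc))) (interchange (f 0) (g 0) (∑ n (f ∘ suc)) (∑ n (g ∘ suc)))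

  *-distribˡ-∑ : ∀ n a (f : ℕ → ℚ) → a * ∑ n f ≡ ∑ n (λ i → a * f i)
  *-distribˡ-∑ zero    a f = ℚ.*-zeroʳ a
  *-distribˡ-∑ (suc n) a f = trans (ℚ.*-distribˡ-+ a (f 0) (∑ n (f ∘ suc))) (cong (a * f 0 +_) (*-distribˡ-∑ n a (f ∘ suc)))

  *-distribʳ-∑ : ∀ n a (f : ℕ → ℚ) → ∑ n f * a ≡ ∑ n (λ i → f i * a)
  *-distribʳ-∑ n a f = trans (ℚ.*-comm (∑ n f) a) (trans (*-distribˡ-∑ n a f) (∑-cong n (λ i _ → ℚ.*-comm a (f i))))

  ∑-last : ∀ n (f : ℕ → ℚ) → ∑ (suc n) f ≡ ∑ n f + f n
  ∑-last zero    f = trans (ℚ.+-identityʳ (f 0)) (sym (ℚ.+-identityˡ (f 0)))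
  ∑-last (suc n) f = trans (cong (f 0 +_) (∑-last n (f ∘ suc))) (sym (ℚ.+-assoc (f 0) (∑ n (f ∘ suc)) (f (suc n))))

  ∑-pad : ∀ m k (f : ℕ → ℚ) → (∀ j → m ≤ j → f j ≡ 0ℚ) → ∑ (m ℕ.+ k) f ≡ ∑ m f
  ∑-pad zero    k f f≡0 = ∑-zero k (λ j _ → f≡0 j z≤n)
  ∑-pad (suc m) k f f≡0 = cong (f 0 +_) (∑-pad m k (f ∘ suc) (λ j m≤j → f≡0 (suc j) (s≤s m≤j)))

  ∑-reverse : ∀ n (f : ℕ → ℚ) → ∑ (suc n) f ≡ ∑ (suc n) (λ i → f (n ∸ i))
  ∑-reverse zero    f = refl
  ∑-reverse (suc n) f = begin
    f 0 + ∑ (suc n) (f ∘ suc)                            ≡⟨ cong (f 0 +_) (∑-reverse n (f ∘ suc)) ⟩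
    f 0 + ∑ (suc n) (λ i → f (suc (n ∸ i)))              ≡⟨ ℚ.+-comm (f 0) _ ⟩
    ∑ (suc n) (λ i → f (suc (n ∸ i))) + f 0              ≡⟨ cong₂ _+_ (∑-cong (suc n) (λ i i≤n → cong f (sym (ℕ.+-∸-assoc 1 (ℕ.≤-pred i≤n)))))
                                                                      (cong f (sym (ℕ.n∸n≡0 (suc n)))) ⟩
    ∑ (suc n) (λ i → f (suc n ∸ i)) + f (suc n ∸ suc n)  ≡⟨ ∑-last (suc n) (λ i → f (suc n ∸ i)) ⟨
    ∑ (suc (suc n)) (λ i → f (suc n ∸ i))                ∎
    where open ≡-Reasoning

  ∑-triangle : ∀ n (b : ℕ → ℕ → ℚ) →
    ∑ (suc n) (λ i → ∑ (suc i) (b i)) ≡ ∑ (suc n) (λ j → ∑ (suc (n ∸ j)) (λ l → b (j ℕ.+ l) j))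
  ∑-triangle zero    b = refl
  ∑-triangle (suc n) b = begin
    ∑ (suc (suc n)) (λ i → ∑ (suc i) (b i))
      ≡⟨ ∑-last (suc n) (λ i → ∑ (suc i) (b i)) ⟩
    ∑ (suc n) (λ i → ∑ (suc i) (b i)) + ∑ (suc (suc n)) (b (suc n))
      ≡⟨ cong₂ _+_ (∑-triangle n b) (∑-last (suc n) (b (suc n))) ⟩
    ∑ (suc n) column + (∑ (suc n) (b (suc n)) + b (suc n) (suc n))
      ≡⟨ ℚ.+-assoc (∑ (suc n) column) (∑ (suc n) (b (suc n))) (b (suc n) (suc n)) ⟨
    ∑ (suc n) column + ∑ (suc n) (b (suc n)) + b (suc n) (suc n)
      ≡⟨ cong₂ _+_ (∑-distrib-+ (suc n) column (b (suc n))) column′-top ⟨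
    ∑ (suc n) (λ j → column j + b (suc n) j) + column′ (suc n)
      ≡⟨ cong (_+ column′ (suc n)) (∑-cong (suc n) (λ j j≤n → sym (column′-split j (ℕ.≤-pred j≤n)))) ⟩
    ∑ (suc n) column′ + column′ (suc n)
      ≡⟨ ∑-last (suc n) column′ ⟨
    ∑ (suc (suc n)) column′ ∎
    where
    open ≡-Reasoning
    column column′ : ℕ → ℚ
    column  j = ∑ (suc (n ∸ j)) (λ l → b (j ℕ.+ l) j)
    column′ j = ∑ (suc (suc n ∸ j)) (λ l → b (j ℕ.+ l) j)
    column′-split : ∀ j → j ≤ n → column′ j ≡ column j + b (suc n) j
    column′-split j j≤n = begin
      column′ j                                     ≡⟨ cong (λ m → ∑ (suc m) (λ l → b (j ℕ.+ l) j)) (ℕ.+-∸-assoc 1 j≤n) ⟩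
      ∑ (suc (suc (n ∸ j))) (λ l → b (j ℕ.+ l) j)   ≡⟨ ∑-last (suc (n ∸ j)) (λ l → b (j ℕ.+ l) j) ⟩
      column j + b (j ℕ.+ suc (n ∸ j)) j            ≡⟨ cong (λ m → column j + b m j) (trans (ℕ.+-suc j (n ∸ j)) (cong suc (ℕ.m+[n∸m]≡n j≤n))) ⟩
      column j + b (suc n) j                        ∎
    column′-top : column′ (suc n) ≡ b (suc n) (suc n)
    column′-top = begin
      column′ (suc n)               ≡⟨ cong (λ m → ∑ (suc m) (λ l → b (suc n ℕ.+ l) (suc n))) (ℕ.n∸n≡0 n) ⟩
      b (suc n ℕ.+ 0) (suc n) + 0ℚ  ≡⟨ ℚ.+-identityʳ _ ⟩
      b (suc n ℕ.+ 0) (suc n)       ≡⟨ cong (λ m → b m (suc n)) (ℕ.+-identityʳ (suc n)) ⟩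
      b (suc n) (suc n)             ∎

  -- The ring of formal power series

  infix 4 _≋_
  record _≋_ (f g : Series) : Set where
    constructor coefficientwise
    field coeff : ∀ n → f n ≡ g n
  open _≋_

  infixl 6 _⊕_
  _⊕_ : Series → Series → Series
  (f ⊕ g) n = f n + g n

  ⊖_ : Series → Series
  (⊖ f) n = - f n

  𝟘 : Series
  𝟘 _ = 0ℚ

  ·-coeff : ∀ f g n → (f · g) n ≡ ∑ (suc n) (λ i → f i * g (n ∸ i))
  ·-coeff f g n = Σ≤≡∑ n (λ i → f i * g (n ∸ i))

  ·-local : ∀ h {f f′} n → (∀ i → i ≤ n → f i ≡ f′ i) → (h · f) n ≡ (h · f′) n
  ·-local h {f} {f′} n f≡f′ = begin
    (h · f) n                             ≡⟨ ·-coeff h f n ⟩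
    ∑ (suc n) (λ i → h i * f (n ∸ i))     ≡⟨ ∑-cong (suc n) (λ i _ → cong (h i *_) (f≡f′ (n ∸ i) (ℕ.m∸n≤m n i))) ⟩
    ∑ (suc n) (λ i → h i * f′ (n ∸ i))    ≡⟨ ·-coeff h f′ n ⟨
    (h · f′) n                            ∎
    where open ≡-Reasoning

  ·-coeff-zero : ∀ f g → (f · g) 0 ≡ f 0 * g 0
  ·-coeff-zero f g = ℚ.+-identityʳ (f 0 * g 0)

  ·-coeff-zero≡0 : ∀ f x → f 0 ≡ 0ℚ → (f · x) 0 ≡ 0ℚ
  ·-coeff-zero≡0 f x f₀≡0 = trans (·-coeff-zero f x) (trans (cong (_* x 0) f₀≡0) (ℚ.*-zeroˡ (x 0)))

  ·-coeff-suc : ∀ f g n → (f · g) (suc n) ≡ f 0 * g (suc n) + (shift f · g) n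
  ·-coeff-suc f g n = trans (·-coeff f g (suc n)) (cong (f 0 * g (suc n) +_) (sym (·-coeff (shift f) g n)))

  shift-· : ∀ f g → f 0 ≡ 0ℚ → ∀ n → (f · g) (suc n) ≡ (shift f · g) n
  shift-· f g f₀≡0 n = begin
    (f · g) (suc n)                          ≡⟨ ·-coeff-suc f g n ⟩
    f 0 * g (suc n) + (shift f · g) n        ≡⟨ cong (λ a → a * g (suc n) + (shift f · g) n) f₀≡0 ⟩
    0ℚ * g (suc n) + (shift f · g) n         ≡⟨ cong (_+ (shift f · g) n) (ℚ.*-zeroˡ (g (suc n))) ⟩
    0ℚ + (shift f · g) n                     ≡⟨ ℚ.+-identityˡ ((shift f · g) n) ⟩
    (shift f · g) n                          ∎
    where open ≡-Reasoning

  ·-cong : ∀ {f f′ g g′} → f ≋ f′ → g ≋ g′ → f · g ≋ f′ · g′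
  ·-cong {f} {f′} {g} {g′} f≋f′ g≋g′ = coefficientwise λ n → begin
    (f · g) n                            ≡⟨ ·-coeff f g n ⟩
    ∑ (suc n) (λ i → f i * g (n ∸ i))    ≡⟨ ∑-cong (suc n) (λ i _ → cong₂ _*_ (coeff f≋f′ i) (coeff g≋g′ (n ∸ i))) ⟩
    ∑ (suc n) (λ i → f′ i * g′ (n ∸ i))  ≡⟨ ·-coeff f′ g′ n ⟨
    (f′ · g′) n                          ∎
    where open ≡-Reasoning

  ·-comm : ∀ f g → f · g ≋ g · f
  ·-comm f g = coefficientwise λ n → begin
    (f · g) n                                      ≡⟨ ·-coeff f g n ⟩
    ∑ (suc n) (λ i → f i * g (n ∸ i))              ≡⟨ ∑-reverse n (λ i → f i * g (n ∸ i)) ⟩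
    ∑ (suc n) (λ i → f (n ∸ i) * g (n ∸ (n ∸ i)))  ≡⟨ ∑-cong (suc n) (λ i i≤n → trans (cong (λ m → f (n ∸ i) * g m) (ℕ.m∸[m∸n]≡n (ℕ.≤-pred i≤n)))
                                                                                     (ℚ.*-comm (f (n ∸ i)) (g i))) ⟩
    ∑ (suc n) (λ i → g i * f (n ∸ i))              ≡⟨ ·-coeff g f n ⟨
    (g · f) n                                      ∎
    where open ≡-Reasoning

  ·-assoc : ∀ f g h → (f · g) · h ≋ f · (g · h)
  ·-assoc f g h = coefficientwise λ n → begin
    ((f · g) · h) n
      ≡⟨ ·-coeff (f · g) h n ⟩
    ∑ (suc n) (λ i → (f · g) i * h (n ∸ i))
      ≡⟨ ∑-cong (suc n) (λ i _ → trans (cong (_* h (n ∸ i)) (·-coeff f g i)) (*-distribʳ-∑ (suc i) (h (n ∸ i)) (λ j → f j * g (i ∸ j)))) ⟩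
    ∑ (suc n) (λ i → ∑ (suc i) (λ j → f j * g (i ∸ j) * h (n ∸ i)))
      ≡⟨ ∑-triangle n (λ i j → f j * g (i ∸ j) * h (n ∸ i)) ⟩
    ∑ (suc n) (λ j → ∑ (suc (n ∸ j)) (λ l → f j * g (j ℕ.+ l ∸ j) * h (n ∸ (j ℕ.+ l))))
      ≡⟨ ∑-cong (suc n) (λ j _ → ∑-cong (suc (n ∸ j)) (λ l _ →
           trans (cong₂ (λ a b → f j * g a * h b) (ℕ.m+n∸m≡n j l) (sym (ℕ.∸-+-assoc n j l))) (ℚ.*-assoc (f j) (g l) (h (n ∸ j ∸ l))))) ⟩
    ∑ (suc n) (λ j → ∑ (suc (n ∸ j)) (λ l → f j * (g l * h (n ∸ j ∸ l))))
      ≡⟨ ∑-cong (suc n) (λ j _ → trans (cong (f j *_) (·-coeff g h (n ∸ j))) (*-distribˡ-∑ (suc (n ∸ j)) (f j) (λ l → g l * h (n ∸ j ∸ l)))) ⟨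
    ∑ (suc n) (λ j → f j * (g · h) (n ∸ j))
      ≡⟨ ·-coeff f (g · h) n ⟨
    (f · (g · h)) n ∎
    where open ≡-Reasoning

  ·-identityˡ : ∀ f → one · f ≋ f
  ·-identityˡ f = coefficientwise λ n → begin
    (one · f) n                                ≡⟨ ·-coeff one f n ⟩
    1ℚ * f n + ∑ n (λ i → 0ℚ * f (n ∸ suc i))  ≡⟨ cong₂ _+_ (ℚ.*-identityˡ (f n)) (∑-zero n (λ i _ → ℚ.*-zeroˡ (f (n ∸ suc i)))) ⟩
    f n + 0ℚ                                   ≡⟨ ℚ.+-identityʳ (f n) ⟩
    f n                                        ∎
    where open ≡-Reasoning

  ·-distribˡ-⊕ : ∀ f g h → f · (g ⊕ h) ≋ f · g ⊕ f · h
  ·-distribˡ-⊕ f g h = coefficientwise λ n → begin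
    (f · (g ⊕ h)) n
      ≡⟨ ·-coeff f (g ⊕ h) n ⟩
    ∑ (suc n) (λ i → f i * (g (n ∸ i) + h (n ∸ i)))
      ≡⟨ ∑-cong (suc n) (λ i _ → ℚ.*-distribˡ-+ (f i) (g (n ∸ i)) (h (n ∸ i))) ⟩
    ∑ (suc n) (λ i → f i * g (n ∸ i) + f i * h (n ∸ i))
      ≡⟨ ∑-distrib-+ (suc n) (λ i → f i * g (n ∸ i)) (λ i → f i * h (n ∸ i)) ⟩
    ∑ (suc n) (λ i → f i * g (n ∸ i)) + ∑ (suc n) (λ i → f i * h (n ∸ i))
      ≡⟨ cong₂ _+_ (·-coeff f g n) (·-coeff f h n) ⟨
    (f · g ⊕ f · h) n ∎
    where open ≡-Reasoning

  seriesRing : CommutativeRing 0ℓ 0ℓ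
  seriesRing = record
    { Carrier = Series ; _≈_ = _≋_ ; _+_ = _⊕_ ; _*_ = _·_ ; -_ = ⊖_ ; 0# = 𝟘 ; 1# = one
    ; isCommutativeRing = record
      { isRing = record
        { +-isAbelianGroup = record
          { isGroup = record
            { isMonoid = record
              { isSemigroup = record
                { isMagma = record
                  { isEquivalence = record
                    { refl = coefficientwise λ _ → refl
                    ; sym = λ p → coefficientwise λ n → sym (coeff p n)
                    ; trans = λ p q → coefficientwise λ n → trans (coeff p n) (coeff q n) }
                  ; ∙-cong = λ p q → coefficientwise λ n → cong₂ _+_ (coeff p n) (coeff q n) }
                ; assoc = λ f g h → coefficientwise λ n → ℚ.+-assoc (f n) (g n) (h n) }
              ; identity = (λ f → coefficientwise λ n → ℚ.+-identityˡ (f n)) , (λ f → coefficientwise λ n → ℚ.+-identityʳ (f n)) }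
            ; inverse = (λ f → coefficientwise λ n → ℚ.+-inverseˡ (f n)) , (λ f → coefficientwise λ n → ℚ.+-inverseʳ (f n))
            ; ⁻¹-cong = λ p → coefficientwise λ n → cong -_ (coeff p n) }
          ; comm = λ f g → coefficientwise λ n → ℚ.+-comm (f n) (g n) }
        ; *-cong = ·-cong
        ; *-assoc = ·-assoc
        ; *-identity = ·-identityˡ , λ f → coefficientwise λ n → trans (coeff (·-comm f one) n) (coeff (·-identityˡ f) n)
        ; distrib = ·-distribˡ-⊕ , λ f g h → coefficientwise λ n →
            trans (coeff (·-comm (g ⊕ h) f) n) (trans (coeff (·-distribˡ-⊕ f g h) n) (cong₂ _+_ (coeff (·-comm f g) n) (coeff (·-comm f h) n))) }
      ; *-comm = ·-comm } }

  module S = CommutativeRing seriesRing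
  module ≈-Reasoning = SetoidReasoning S.setoid
  module SeriesSolver = NaturalCoefficientSolver S.commutativeSemiring
  open GroupProperties S.+-group using () renaming (∙-cancelˡ to ⊕-cancelˡ)

  constant : ℚ → Series
  constant a zero    = a
  constant a (suc _) = 0ℚ

  constant-· : ∀ a f n → (constant a · f) n ≡ a * f n
  constant-· a f n = begin
    (constant a · f) n                        ≡⟨ ·-coeff (constant a) f n ⟩
    a * f n + ∑ n (λ i → 0ℚ * f (n ∸ suc i))  ≡⟨ cong (a * f n +_) (∑-zero n (λ i _ → ℚ.*-zeroˡ (f (n ∸ suc i)))) ⟩
    a * f n + 0ℚ                              ≡⟨ ℚ.+-identityʳ (a * f n) ⟩
    a * f n                                   ∎
    where open ≡-Reasoning

  constant-homo-+ : ∀ a b → constant (a + b) ≋ constant a ⊕ constant b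
  constant-homo-+ a b = coefficientwise λ { zero → refl ; (suc n) → sym (ℚ.+-identityʳ 0ℚ) }

  constant-one : constant 1ℚ ≋ one
  constant-one = coefficientwise λ { zero → refl ; (suc n) → refl }

  -- Formal derivative

  -- t · d/dt, for which the Leibniz rule needs no index shift: n = i + (n ∸ i) splits each term.
  euler : Series → Series
  euler f n = ℕ→ℚ n * f n

  ∂ : Series → Series
  ∂ f = shift (euler f)

  euler-· : ∀ f g → euler (f · g) ≋ euler f · g ⊕ f · euler g
  euler-· f g = coefficientwise λ n → begin
    ℕ→ℚ n * (f · g) n
      ≡⟨ cong (ℕ→ℚ n *_) (·-coeff f g n) ⟩
    ℕ→ℚ n * ∑ (suc n) (λ i → f i * g (n ∸ i))
      ≡⟨ *-distribˡ-∑ (suc n) (ℕ→ℚ n) (λ i → f i * g (n ∸ i)) ⟩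
    ∑ (suc n) (λ i → ℕ→ℚ n * (f i * g (n ∸ i)))
      ≡⟨ ∑-cong (suc n) (λ i i≤n → split n i (ℕ.≤-pred i≤n)) ⟩
    ∑ (suc n) (λ i → ℕ→ℚ i * f i * g (n ∸ i) + f i * (ℕ→ℚ (n ∸ i) * g (n ∸ i)))
      ≡⟨ ∑-distrib-+ (suc n) (λ i → ℕ→ℚ i * f i * g (n ∸ i)) (λ i → f i * (ℕ→ℚ (n ∸ i) * g (n ∸ i))) ⟩
    ∑ (suc n) (λ i → ℕ→ℚ i * f i * g (n ∸ i)) + ∑ (suc n) (λ i → f i * (ℕ→ℚ (n ∸ i) * g (n ∸ i)))
      ≡⟨ cong₂ _+_ (·-coeff (euler f) g n) (·-coeff f (euler g) n) ⟨
    (euler f · g ⊕ f · euler g) n ∎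
    where
    open ≡-Reasoning
    split : ∀ n i → i ≤ n → ℕ→ℚ n * (f i * g (n ∸ i)) ≡ ℕ→ℚ i * f i * g (n ∸ i) + f i * (ℕ→ℚ (n ∸ i) * g (n ∸ i))
    split n i i≤n = begin
      ℕ→ℚ n * (f i * g (n ∸ i))                 ≡⟨ cong (λ m → ℕ→ℚ m * (f i * g (n ∸ i))) (ℕ.m+[n∸m]≡n i≤n) ⟨
      ℕ→ℚ (i ℕ.+ (n ∸ i)) * (f i * g (n ∸ i))   ≡⟨ cong (_* (f i * g (n ∸ i))) (ℕ→ℚ-homo-+ i (n ∸ i)) ⟩
      (ℕ→ℚ i + ℕ→ℚ (n ∸ i)) * (f i * g (n ∸ i)) ≡⟨ solve 4 (λ a b x y → (a :+ b) :* (x :* y) := a :* x :* y :+ x :* (b :* y))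
                                                          refl (ℕ→ℚ i) (ℕ→ℚ (n ∸ i)) (f i) (g (n ∸ i)) ⟩
      ℕ→ℚ i * f i * g (n ∸ i) + f i * (ℕ→ℚ (n ∸ i) * g (n ∸ i)) ∎
      where open +-*-Solver

  ∂-· : ∀ f g → ∂ (f · g) ≋ ∂ f · g ⊕ f · ∂ g
  ∂-· f g = coefficientwise λ n → begin
    euler (f · g) (suc n)                          ≡⟨ coeff (euler-· f g) (suc n) ⟩
    (euler f · g) (suc n) + (f · euler g) (suc n)  ≡⟨ cong ((euler f · g) (suc n) +_) (coeff (·-comm f (euler g)) (suc n)) ⟩
    (euler f · g) (suc n) + (euler g · f) (suc n)  ≡⟨ cong₂ _+_ (shift-· (euler f) g (ℚ.*-zeroˡ (f 0)) n) (shift-· (euler g) f (ℚ.*-zeroˡ (g 0)) n) ⟩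
    (∂ f · g) n + (∂ g · f) n                      ≡⟨ cong ((∂ f · g) n +_) (coeff (·-comm (∂ g) f) n) ⟩
    (∂ f · g ⊕ f · ∂ g) n                          ∎
    where open ≡-Reasoning

  ∂-⊕ : ∀ f g → ∂ (f ⊕ g) ≋ ∂ f ⊕ ∂ g
  ∂-⊕ f g = coefficientwise λ n → ℚ.*-distribˡ-+ (ℕ→ℚ (suc n)) (f (suc n)) (g (suc n))

  ∂-cong : ∀ {f g} → f ≋ g → ∂ f ≋ ∂ g
  ∂-cong f≋g = coefficientwise λ n → cong (ℕ→ℚ (suc n) *_) (coeff f≋g (suc n))

  ∂-constant : ∀ a → ∂ (constant a) ≋ 𝟘
  ∂-constant a = coefficientwise λ n → ℚ.*-zeroʳ (ℕ→ℚ (suc n))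

  ∂-one : ∂ one ≋ 𝟘
  ∂-one = coefficientwise λ n → ℚ.*-zeroʳ (ℕ→ℚ (suc n))

  ∂-injective : ∀ {f g} → ∂ f ≋ ∂ g → f 0 ≡ g 0 → f ≋ g
  ∂-injective ∂f≋∂g f₀≡g₀ = coefficientwise λ
    { zero    → f₀≡g₀
    ; (suc n) → *-cancelˡ-ℕ→ℚ (suc n) (coeff ∂f≋∂g n) }

  ∂-system-unique : ∀ {u v u′ v′} → ∂ u ≋ v → ∂ v ≋ u → ∂ u′ ≋ v′ → ∂ v′ ≋ u′ →
                    u 0 ≡ u′ 0 → v 0 ≡ v′ 0 → u ≋ u′
  ∂-system-unique {u} {v} {u′} {v′} ∂u ∂v ∂u′ ∂v′ u₀ v₀ = coefficientwise (proj₁ ∘ agree)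
    where
    agree : ∀ n → u n ≡ u′ n × v n ≡ v′ n
    agree zero    = u₀ , v₀
    agree (suc n) with agree n
    ... | uₙ , vₙ = *-cancelˡ-ℕ→ℚ (suc n) (trans (coeff ∂u n) (trans vₙ (sym (coeff ∂u′ n))))
                  , *-cancelˡ-ℕ→ℚ (suc n) (trans (coeff ∂v n) (trans uₙ (sym (coeff ∂v′ n))))

  -- Division by a series with constant term 1

  revQuot-applyUpTo : ∀ g s n → revQuot g s n ≡ applyUpTo (λ i → (g ÷ₛ s) (n ∸ i)) (suc n)
  revQuot-applyUpTo g s zero    = refl
  revQuot-applyUpTo g s (suc n) = cong ((g ÷ₛ s) (suc n) ∷_) (revQuot-applyUpTo g s n)

  zipWith-applyUpTo : ∀ {A B C : Set} (f : A → B → C) a b n →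
                      zipWith f (applyUpTo a n) (applyUpTo b n) ≡ applyUpTo (λ i → f (a i) (b i)) n
  zipWith-applyUpTo f a b zero    = refl
  zipWith-applyUpTo f a b (suc n) = cong (f (a 0) (b 0) ∷_) (zipWith-applyUpTo f (a ∘ suc) (b ∘ suc) n)

  ÷ₛ-suc : ∀ g s n → (g ÷ₛ s) (suc n) ≡ g (suc n) - (shift s · (g ÷ₛ s)) n
  ÷ₛ-suc g s n = begin
    g (suc n) - foldr _+_ 0ℚ (zipWith term (upTo (length (revQuot g s n))) (revQuot g s n))
      ≡⟨ cong (λ r → g (suc n) - foldr _+_ 0ℚ (zipWith term (upTo (length r)) r)) (revQuot-applyUpTo g s n) ⟩
    g (suc n) - foldr _+_ 0ℚ (zipWith term (upTo (length (applyUpTo q (suc n)))) (applyUpTo q (suc n)))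
      ≡⟨ cong (λ m → g (suc n) - foldr _+_ 0ℚ (zipWith term (upTo m) (applyUpTo q (suc n)))) (length-applyUpTo q (suc n)) ⟩
    g (suc n) - foldr _+_ 0ℚ (zipWith term (upTo (suc n)) (applyUpTo q (suc n)))
      ≡⟨ cong (λ l → g (suc n) - foldr _+_ 0ℚ l) (zipWith-applyUpTo term (λ j → j) q (suc n)) ⟩
    g (suc n) - foldr _+_ 0ℚ (applyUpTo (λ j → term j (q j)) (suc n))
      ≡⟨ cong (λ x → g (suc n) - x) (trans (foldr-+-applyUpTo (suc n) (λ j → term j (q j))) (sym (·-coeff (shift s) (g ÷ₛ s) n))) ⟩
    g (suc n) - (shift s · (g ÷ₛ s)) n ∎
    where
    open ≡-Reasoning
    term : ℕ → ℚ → ℚ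
    term j x = s (suc j) * x
    q : ℕ → ℚ
    q i = (g ÷ₛ s) (n ∸ i)

  ·-coeff-suc-unit : ∀ s x n → s 0 ≡ 1ℚ → (s · x) (suc n) ≡ x (suc n) + (shift s · x) n
  ·-coeff-suc-unit s x n s₀≡1 = trans (·-coeff-suc s x n)
    (cong (_+ (shift s · x) n) (trans (cong (_* x (suc n)) s₀≡1) (ℚ.*-identityˡ (x (suc n)))))

  ·-coeff-zero-unit : ∀ s x → s 0 ≡ 1ℚ → (s · x) 0 ≡ x 0
  ·-coeff-zero-unit s x s₀≡1 = trans (·-coeff-zero s x) (trans (cong (_* x 0) s₀≡1) (ℚ.*-identityˡ (x 0)))

  ·-÷ₛ : ∀ g s → s 0 ≡ 1ℚ → s · (g ÷ₛ s) ≋ g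
  ·-÷ₛ g s s₀≡1 = coefficientwise λ
    { zero    → ·-coeff-zero-unit s (g ÷ₛ s) s₀≡1
    ; (suc n) → begin
        (s · (g ÷ₛ s)) (suc n)                                        ≡⟨ ·-coeff-suc-unit s (g ÷ₛ s) n s₀≡1 ⟩
        (g ÷ₛ s) (suc n) + (shift s · (g ÷ₛ s)) n                     ≡⟨ cong (_+ (shift s · (g ÷ₛ s)) n) (÷ₛ-suc g s n) ⟩
        g (suc n) - (shift s · (g ÷ₛ s)) n + (shift s · (g ÷ₛ s)) n   ≡⟨ solve 2 (λ a b → a :- b :+ b := a) refl (g (suc n)) ((shift s · (g ÷ₛ s)) n) ⟩
        g (suc n)                                                     ∎ }
    where
    open ≡-Reasoning
    open +-*-Solver

  ·-cancelˡ-unit : ∀ s {x y} → s 0 ≡ 1ℚ → s · x ≋ s · y → x ≋ y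
  ·-cancelˡ-unit s {x} {y} s₀≡1 sx≋sy = coefficientwise λ n → agree n n ℕ.≤-refl
    where
    open ≡-Reasoning
    agree : ∀ n m → m ≤ n → x m ≡ y m
    agree n zero _ = begin
      x 0        ≡⟨ ·-coeff-zero-unit s x s₀≡1 ⟨
      (s · x) 0  ≡⟨ coeff sx≋sy 0 ⟩
      (s · y) 0  ≡⟨ ·-coeff-zero-unit s y s₀≡1 ⟩
      y 0        ∎
    agree (suc n) (suc m) (s≤s m≤n) = +-cancelʳ ((shift s · x) m) (x (suc m)) (y (suc m)) (begin
      x (suc m) + (shift s · x) m  ≡⟨ ·-coeff-suc-unit s x m s₀≡1 ⟨
      (s · x) (suc m)              ≡⟨ coeff sx≋sy (suc m) ⟩
      (s · y) (suc m)              ≡⟨ ·-coeff-suc-unit s y m s₀≡1 ⟩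
      y (suc m) + (shift s · y) m  ≡⟨ cong (y (suc m) +_) (·-local (shift s) m (λ i i≤m → agree n i (ℕ.≤-trans i≤m m≤n))) ⟨
      y (suc m) + (shift s · x) m  ∎)

  -- Hyperbolic functions and tanh(t/2)

  cosh : Series
  cosh n = even? n * inv! n

  ½ : Series
  ½ = constant (half^ 1)

  ½⊕½ : ½ ⊕ ½ ≋ one
  ½⊕½ = coefficientwise λ { zero → refl ; (suc n) → refl }

  ∂-egf : ∀ (a : ℕ → ℚ) → ∂ (λ n → a n * inv! n) ≋ (λ n → a (suc n) * inv! n)
  ∂-egf a = coefficientwise λ n → begin
    ℕ→ℚ (suc n) * (a (suc n) * inv! (suc n))  ≡⟨ x∙yz≈y∙xz (ℕ→ℚ (suc n)) (a (suc n)) (inv! (suc n)) ⟩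
    a (suc n) * (ℕ→ℚ (suc n) * inv! (suc n))  ≡⟨ cong (a (suc n) *_) (inv!-suc n) ⟩
    a (suc n) * inv! n                        ∎
    where open ≡-Reasoning

  ∂-egf-half : ∀ (a : ℕ → ℚ) → ∂ (λ n → a n * half^ n * inv! n) ≋ ½ · (λ n → a (suc n) * half^ n * inv! n)
  ∂-egf-half a = coefficientwise λ n → begin
    ∂ (λ n → a n * half^ n * inv! n) n              ≡⟨ coeff (∂-egf (λ n → a n * half^ n)) n ⟩
    a (suc n) * half^ (suc n) * inv! n              ≡⟨ cong (λ h → a (suc n) * h * inv! n) (half^-suc n) ⟩
    a (suc n) * (half^ 1 * half^ n) * inv! n        ≡⟨ solve 4 (λ x h y z → x :* (h :* y) :* z := h :* (x :* y :* z)) refl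
                                                               (a (suc n)) (half^ 1) (half^ n) (inv! n) ⟩
    half^ 1 * (a (suc n) * half^ n * inv! n)        ≡⟨ constant-· (half^ 1) (λ n → a (suc n) * half^ n * inv! n) n ⟨
    (½ · (λ n → a (suc n) * half^ n * inv! n)) n    ∎
    where
    open ≡-Reasoning
    open +-*-Solver

  ∂-sinh : ∂ sinh ≋ cosh
  ∂-sinh = ∂-egf odd?

  ∂-cosh : ∂ cosh ≋ sinh
  ∂-cosh = ∂-egf even?

  ∂-sinhHalf : ∂ sinhHalf ≋ ½ · coshHalf
  ∂-sinhHalf = ∂-egf-half odd?

  ∂-coshHalf : ∂ coshHalf ≋ ½ · sinhHalf
  ∂-coshHalf = ∂-egf-half even?

  coshHalf²≋1+sinhHalf² : coshHalf · coshHalf ≋ one ⊕ sinhHalf · sinhHalf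
  coshHalf²≋1+sinhHalf² = ∂-injective (begin
    ∂ (c · c)                            ≈⟨ ∂-· c c ⟩
    ∂ c · c ⊕ c · ∂ c                    ≈⟨ S.+-cong (S.*-congʳ {c} ∂-coshHalf) (S.*-congˡ {c} ∂-coshHalf) ⟩
    (½ · s) · c ⊕ c · (½ · s)            ≈⟨ solve 3 (λ h s c → (h :* s) :* c :+ c :* (h :* s) := con 0 :+ ((h :* c) :* s :+ s :* (h :* c))) S.refl ½ s c ⟩
    𝟘 ⊕ ((½ · c) · s ⊕ s · (½ · c))      ≈⟨ S.+-cong ∂-one (S.+-cong (S.*-congʳ {s} ∂-sinhHalf) (S.*-congˡ {s} ∂-sinhHalf)) ⟨
    ∂ one ⊕ (∂ s · s ⊕ s · ∂ s)          ≈⟨ S.+-congˡ {∂ one} (∂-· s s) ⟨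
    ∂ one ⊕ ∂ (s · s)                    ≈⟨ ∂-⊕ one (s · s) ⟨
    ∂ (one ⊕ s · s)                      ∎) refl
    where
    open ≈-Reasoning
    open SeriesSolver
    s = sinhHalf
    c = coshHalf

  sinh≋2sinhHalf·coshHalf : sinh ≋ sinhHalf · coshHalf ⊕ sinhHalf · coshHalf
  sinh≋2sinhHalf·coshHalf = S.sym (∂-system-unique ∂P ∂Q ∂-sinh ∂-cosh refl refl)
    where
    open ≈-Reasoning
    open SeriesSolver
    s = sinhHalf
    c = coshHalf
    P = s · c ⊕ s · c
    Q = c · c ⊕ s · s
    ∂s·c : ∂ (s · c) ≋ (½ · c) · c ⊕ s · (½ · s)
    ∂s·c = S.trans (∂-· s c) (S.+-cong (S.*-congʳ {c} ∂-sinhHalf) (S.*-congˡ {s} ∂-coshHalf))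
    ∂P : ∂ P ≋ Q
    ∂P = begin
      ∂ (s · c ⊕ s · c)                                       ≈⟨ S.trans (∂-⊕ (s · c) (s · c)) (S.+-cong ∂s·c ∂s·c) ⟩
      ((½ · c) · c ⊕ s · (½ · s)) ⊕ ((½ · c) · c ⊕ s · (½ · s)) ≈⟨ solve 3 (λ h s c → ((h :* c) :* c :+ s :* (h :* s)) :+ ((h :* c) :* c :+ s :* (h :* s))
                                                                              := (h :+ h) :* (c :* c :+ s :* s)) S.refl ½ s c ⟩
      (½ ⊕ ½) · Q                                             ≈⟨ S.*-congʳ {Q} ½⊕½ ⟩
      one · Q                                                 ≈⟨ S.*-identityˡ Q ⟩
      Q                                                       ∎
    ∂Q : ∂ Q ≋ P
    ∂Q = begin
      ∂ (c · c ⊕ s · s)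
        ≈⟨ S.trans (∂-⊕ (c · c) (s · s)) (S.+-cong (S.trans (∂-· c c) (S.+-cong (S.*-congʳ {c} ∂-coshHalf) (S.*-congˡ {c} ∂-coshHalf)))
                                                    (S.trans (∂-· s s) (S.+-cong (S.*-congʳ {s} ∂-sinhHalf) (S.*-congˡ {s} ∂-sinhHalf)))) ⟩
      ((½ · s) · c ⊕ c · (½ · s)) ⊕ ((½ · c) · s ⊕ s · (½ · c))
        ≈⟨ solve 3 (λ h s c → ((h :* s) :* c :+ c :* (h :* s)) :+ ((h :* c) :* s :+ s :* (h :* c)) := (h :+ h) :* (s :* c :+ s :* c)) S.refl ½ s c ⟩
      (½ ⊕ ½) · P   ≈⟨ S.*-congʳ {P} ½⊕½ ⟩
      one · P       ≈⟨ S.*-identityˡ P ⟩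
      P             ∎

  sinh·∂tanhHalf≋tanhHalf : sinh · ∂ tanhHalf ≋ tanhHalf
  sinh·∂tanhHalf≋tanhHalf = ·-cancelˡ-unit c refl (begin
    c · (sinh · ∂z)             ≈⟨ S.*-congˡ {c} (S.*-congʳ {∂z} sinh≋2sinhHalf·coshHalf) ⟩
    c · ((s · c ⊕ s · c) · ∂z)  ≈⟨ solve 3 (λ s c d → c :* ((s :* c :+ s :* c) :* d) := (s :+ s) :* (c :* c :* d)) S.refl s c ∂z ⟩
    (s ⊕ s) · ((c · c) · ∂z)      ≈⟨ S.*-congˡ {s ⊕ s} c²∂z≋½ ⟩
    (s ⊕ s) · ½                 ≈⟨ solve 2 (λ s h → (s :+ s) :* h := s :* (h :+ h)) S.refl s ½ ⟩
    s · (½ ⊕ ½)                 ≈⟨ S.*-congˡ {s} ½⊕½ ⟩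
    s · one                     ≈⟨ S.*-identityʳ s ⟩
    s                           ≈⟨ c·z≋s ⟨
    c · z                       ∎)
    where
    open ≈-Reasoning
    open SeriesSolver
    s = sinhHalf
    c = coshHalf
    z = tanhHalf
    ∂z = ∂ tanhHalf
    c·z≋s : c · z ≋ s
    c·z≋s = ·-÷ₛ s c refl
    ∂[c·z] : (½ · s) · z ⊕ c · ∂z ≋ ½ · c
    ∂[c·z] = begin
      (½ · s) · z ⊕ c · ∂z  ≈⟨ S.+-congʳ {c · ∂z} (S.*-congʳ {z} ∂-coshHalf) ⟨
      ∂ c · z ⊕ c · ∂z      ≈⟨ ∂-· c z ⟨
      ∂ (c · z)             ≈⟨ ∂-cong c·z≋s ⟩
      ∂ s                   ≈⟨ ∂-sinhHalf ⟩
      ½ · c                 ∎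
    c²∂z≋½ : (c · c) · ∂z ≋ ½
    c²∂z≋½ = ⊕-cancelˡ (½ · (s · s)) ((c · c) · ∂z) ½ (begin
      ½ · (s · s) ⊕ (c · c) · ∂z        ≈⟨ S.+-congʳ {(c · c) · ∂z} (S.*-congˡ {½} (S.*-congˡ {s} c·z≋s)) ⟨
      ½ · (s · (c · z)) ⊕ (c · c) · ∂z  ≈⟨ solve 5 (λ h s c z d → h :* (s :* (c :* z)) :+ c :* c :* d := c :* ((h :* s) :* z :+ c :* d)) S.refl ½ s c z ∂z ⟩
      c · ((½ · s) · z ⊕ c · ∂z)      ≈⟨ S.*-congˡ {c} ∂[c·z] ⟩
      c · (½ · c)                     ≈⟨ solve 2 (λ h c → c :* (h :* c) := h :* (c :* c)) S.refl ½ c ⟩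
      ½ · (c · c)                     ≈⟨ S.*-congˡ {½} coshHalf²≋1+sinhHalf² ⟩
      ½ · (one ⊕ s · s)               ≈⟨ solve 3 (λ h u s → h :* (u :+ s :* s) := h :* (s :* s) :+ h :* u) S.refl ½ one s ⟩
      ½ · (s · s) ⊕ ½ · one           ≈⟨ S.+-congˡ {½ · (s · s)} (S.*-identityʳ ½) ⟩
      ½ · (s · s) ⊕ ½                 ∎)

  -- The operator h · d/dt

  θ : Series → Series → Series
  θ h f = h · ∂ f

  θ-cong : ∀ h {f g} → f ≋ g → θ h f ≋ θ h g
  θ-cong h f≋g = S.*-congˡ {h} (∂-cong f≋g)

  θ-local : ∀ h {f f′} n → (∀ i → i ≤ suc n → f i ≡ f′ i) → θ h f n ≡ θ h f′ n
  θ-local h n f≡f′ = ·-local h n (λ i i≤n → cong (ℕ→ℚ (suc i) *_) (f≡f′ (suc i) (s≤s i≤n)))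

  θ-⊕ : ∀ h f g → θ h (f ⊕ g) ≋ θ h f ⊕ θ h g
  θ-⊕ h f g = S.trans (S.*-congˡ {h} (∂-⊕ f g)) (S.distribˡ h (∂ f) (∂ g))

  θ-· : ∀ h f g → θ h (f · g) ≋ θ h f · g ⊕ f · θ h g
  θ-· h f g = begin
    h · ∂ (f · g)              ≈⟨ S.*-congˡ {h} (∂-· f g) ⟩
    h · (∂ f · g ⊕ f · ∂ g)    ≈⟨ solve 5 (λ h d f g e → h :* (d :* f :+ g :* e) := (h :* d) :* f :+ g :* (h :* e)) S.refl h (∂ f) g f (∂ g) ⟩
    (h · ∂ f) · g ⊕ f · (h · ∂ g) ∎
    where
    open ≈-Reasoning
    open SeriesSolver

  θ-constant-· : ∀ h a f → θ h (constant a · f) ≋ constant a · θ h f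
  θ-constant-· h a f = begin
    h · ∂ (constant a · f)                         ≈⟨ S.*-congˡ {h} (∂-· (constant a) f) ⟩
    h · (∂ (constant a) · f ⊕ constant a · ∂ f)    ≈⟨ S.*-congˡ {h} (S.+-congʳ {constant a · ∂ f} (S.*-congʳ {f} (∂-constant a))) ⟩
    h · (𝟘 · f ⊕ constant a · ∂ f)                 ≈⟨ solve 4 (λ h f c d → h :* (con 0 :* f :+ c :* d) := c :* (h :* d)) S.refl h f (constant a) (∂ f) ⟩
    constant a · (h · ∂ f)                         ∎
    where
    open ≈-Reasoning
    open SeriesSolver

  θ-pow : ∀ h g → θ h g ≋ g → ∀ j → θ h (pow g j) ≋ constant (ℕ→ℚ j) · pow g j
  θ-pow h g θg≋g zero = begin
    h · ∂ one            ≈⟨ S.*-congˡ {h} ∂-one ⟩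
    h · 𝟘                ≈⟨ S.zeroʳ h ⟩
    𝟘                    ≈⟨ S.zeroˡ one ⟨
    𝟘 · one              ≈⟨ S.*-congʳ {one} {𝟘} {constant 0ℚ} (coefficientwise λ { zero → refl ; (suc n) → refl }) ⟩
    constant 0ℚ · one    ∎
    where open ≈-Reasoning
  θ-pow h g θg≋g (suc j) = begin
    θ h (g · pow g j)                                   ≈⟨ θ-· h g (pow g j) ⟩
    θ h g · pow g j ⊕ g · θ h (pow g j)                 ≈⟨ S.+-cong (S.*-congʳ {pow g j} θg≋g) (S.*-congˡ {g} (θ-pow h g θg≋g j)) ⟩
    g · pow g j ⊕ g · (constant (ℕ→ℚ j) · pow g j)      ≈⟨ solve 3 (λ g p c → g :* p :+ g :* (c :* p) := (con 1 :+ c) :* (g :* p)) S.refl g (pow g j) (constant (ℕ→ℚ j)) ⟩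
    (one ⊕ constant (ℕ→ℚ j)) · pow g (suc j)            ≈⟨ S.*-congʳ {pow g (suc j)} (S.trans (S.reflexive (cong constant (ℕ→ℚ-homo-+ 1 j)))
                                                                               (S.trans (constant-homo-+ 1ℚ (ℕ→ℚ j)) (S.+-congʳ {constant (ℕ→ℚ j)} constant-one))) ⟨
    constant (ℕ→ℚ (suc j)) · pow g (suc j)              ∎
    where
    open ≈-Reasoning
    open SeriesSolver

  combination : ℕ → (ℕ → ℚ) → (ℕ → Series) → Series
  combination m a p n = ∑ m (λ j → a j * p j n)

  combination-suc : ∀ m a p → combination (suc m) a p ≋ constant (a 0) · p 0 ⊕ combination m (a ∘ suc) (p ∘ suc)
  combination-suc m a p = coefficientwise λ n → cong (_+ combination m (a ∘ suc) (p ∘ suc) n) (sym (constant-· (a 0) (p 0) n))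

  θ-combination : ∀ h m a p → θ h (combination m a p) ≋ combination m a (θ h ∘ p)
  θ-combination h zero    a p = S.trans (S.*-congˡ {h} (coefficientwise λ n → ℚ.*-zeroʳ (ℕ→ℚ (suc n)))) (S.zeroʳ h)
  θ-combination h (suc m) a p = begin
    θ h (combination (suc m) a p)                                        ≈⟨ θ-cong h (combination-suc m a p) ⟩
    θ h (constant (a 0) · p 0 ⊕ combination m (a ∘ suc) (p ∘ suc))       ≈⟨ θ-⊕ h (constant (a 0) · p 0) (combination m (a ∘ suc) (p ∘ suc)) ⟩
    θ h (constant (a 0) · p 0) ⊕ θ h (combination m (a ∘ suc) (p ∘ suc)) ≈⟨ S.+-cong (θ-constant-· h (a 0) (p 0)) (θ-combination h m (a ∘ suc) (p ∘ suc)) ⟩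
    constant (a 0) · θ h (p 0) ⊕ combination m (a ∘ suc) (θ h ∘ p ∘ suc) ≈⟨ combination-suc m a (θ h ∘ p) ⟨
    combination (suc m) a (θ h ∘ p)                                      ∎
    where open ≈-Reasoning

  pow-vanishes : ∀ g → g 0 ≡ 0ℚ → ∀ j n → n < j → pow g j n ≡ 0ℚ
  pow-vanishes g g₀≡0 (suc j) zero    _ = ·-coeff-zero≡0 g (pow g j) g₀≡0
  pow-vanishes g g₀≡0 (suc j) (suc n) (s≤s n<j) = begin
    (g · pow g j) (suc n)                          ≡⟨ shift-· g (pow g j) g₀≡0 n ⟩
    (shift g · pow g j) n                          ≡⟨ ·-local (shift g) n (λ i i≤n → pow-vanishes g g₀≡0 j i (ℕ.≤-<-trans i≤n n<j)) ⟩
    (shift g · 𝟘) n                                ≡⟨ coeff (S.zeroʳ (shift g)) n ⟩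
    0ℚ                                             ∎
    where open ≡-Reasoning

  compose-truncate : ∀ f g → g 0 ≡ 0ℚ → ∀ {i N} → i ≤ N → compose f g i ≡ combination (suc N) f (pow g) i
  compose-truncate f g g₀≡0 {i} {N} i≤N = begin
    compose f g i                                           ≡⟨ Σ≤≡∑ i (λ j → f j * pow g j i) ⟩
    ∑ (suc i) (λ j → f j * pow g j i)                       ≡⟨ ∑-pad (suc i) (N ∸ i) (λ j → f j * pow g j i) vanishes ⟨
    ∑ (suc i ℕ.+ (N ∸ i)) (λ j → f j * pow g j i)           ≡⟨ cong (λ m → ∑ (suc m) (λ j → f j * pow g j i)) (ℕ.m+[n∸m]≡n i≤N) ⟩
    combination (suc N) f (pow g) i                         ∎
    where
    open ≡-Reasoning
    vanishes : ∀ j → suc i ≤ j → f j * pow g j i ≡ 0ℚ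
    vanishes j i<j = trans (cong (f j *_) (pow-vanishes g g₀≡0 j i i<j)) (ℚ.*-zeroʳ (f j))

  θ-compose : ∀ h f g → θ h g ≋ g → g 0 ≡ 0ℚ → θ h (compose f g) ≋ compose (λ j → ℕ→ℚ j * f j) g
  θ-compose h f g θg≋g g₀≡0 = coefficientwise λ n → begin
    θ h (compose f g) n                                       ≡⟨ θ-local h n (λ i i≤1+n → compose-truncate f g g₀≡0 i≤1+n) ⟩
    θ h (combination (2 ℕ.+ n) f (pow g)) n                   ≡⟨ coeff (θ-combination h (2 ℕ.+ n) f (pow g)) n ⟩
    ∑ (2 ℕ.+ n) (λ j → f j * θ h (pow g j) n)                 ≡⟨ ∑-cong (2 ℕ.+ n) (λ j _ → cong (f j *_) (coeff (θ-pow h g θg≋g j) n)) ⟩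
    ∑ (2 ℕ.+ n) (λ j → f j * (constant (ℕ→ℚ j) · pow g j) n)  ≡⟨ ∑-cong (2 ℕ.+ n) (λ j _ → scale n j) ⟩
    combination (2 ℕ.+ n) (λ j → ℕ→ℚ j * f j) (pow g) n      ≡⟨ compose-truncate (λ j → ℕ→ℚ j * f j) g g₀≡0 (ℕ.n≤1+n n) ⟨
    compose (λ j → ℕ→ℚ j * f j) g n                           ∎
    where
    open ≡-Reasoning
    scale : ∀ n j → f j * (constant (ℕ→ℚ j) · pow g j) n ≡ ℕ→ℚ j * f j * pow g j n
    scale n j = begin
      f j * (constant (ℕ→ℚ j) · pow g j) n  ≡⟨ cong (f j *_) (constant-· (ℕ→ℚ j) (pow g j) n) ⟩
      f j * (ℕ→ℚ j * pow g j n)             ≡⟨ x∙yz≈y∙xz (f j) (ℕ→ℚ j) (pow g j n) ⟩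
      ℕ→ℚ j * (f j * pow g j n)             ≡⟨ ℚ.*-assoc (ℕ→ℚ j) (f j) (pow g j n) ⟨
      ℕ→ℚ j * f j * pow g j n               ∎

  -- Poly-cosecant series

  invPowZ-pred : ∀ m k → invPowZ (suc m) (k ℤ.- 1ℤ) ≡ ℕ→ℚ (suc m) * invPowZ (suc m) k
  invPowZ-pred m (ℤ.+ zero)  = trans (cong ℕ→ℚ (ℕ.*-identityʳ (suc m))) (sym (ℚ.*-identityʳ (ℕ→ℚ (suc m))))
  invPowZ-pred m (ℤ.+ suc n) = sym (trans (cong (ℕ→ℚ (suc m) *_) (1/-homo-* (suc m) (suc m ^ n) {{_}} {{ℕ.m^n≢0 (suc m) n}}))
                                          (n*[1/n*x]≡x (suc m) (invPowZ (suc m) (ℤ.+ n))))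
  invPowZ-pred m -[1+ n ]    = trans (cong (λ t → ℕ→ℚ (suc m ^ suc (suc t))) (ℕ.+-identityʳ n)) (ℕ→ℚ-homo-* (suc m) (suc m ^ suc n))

  A-pred : ∀ k j → A (k ℤ.- 1ℤ) j ≡ ℕ→ℚ j * A k j
  A-pred k zero    = refl
  A-pred k (suc m) = trans (cong (odd? (suc m) * ℕ→ℚ 2 *_) (invPowZ-pred m k))
                           (x∙yz≈y∙xz (odd? (suc m) * ℕ→ℚ 2) (ℕ→ℚ (suc m)) (invPowZ (suc m) k))

  compose-cong : ∀ {f f′} g → (∀ j → f j ≡ f′ j) → compose f g ≋ compose f′ g
  compose-cong {f} {f′} g f≡f′ = coefficientwise λ n → begin
    compose f g n                        ≡⟨ Σ≤≡∑ n (λ j → f j * pow g j n) ⟩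
    ∑ (suc n) (λ j → f j * pow g j n)    ≡⟨ ∑-cong (suc n) (λ j _ → cong (_* pow g j n) (f≡f′ j)) ⟩
    ∑ (suc n) (λ j → f′ j * pow g j n)   ≡⟨ Σ≤≡∑ n (λ j → f′ j * pow g j n) ⟨
    compose f′ g n                       ∎
    where open ≡-Reasoning

  ·-shift-÷ₛ : ∀ f g → f 0 ≡ 0ℚ → shift f 0 ≡ 1ℚ → g 0 ≡ 0ℚ → f · (shift g ÷ₛ shift f) ≋ g
  ·-shift-÷ₛ f g f₀≡0 f₁≡1 g₀≡0 = coefficientwise λ
    { zero    → trans (·-coeff-zero≡0 f (shift g ÷ₛ shift f) f₀≡0) (sym g₀≡0)
    ; (suc n) → trans (shift-· f (shift g ÷ₛ shift f) f₀≡0 n) (coeff (·-÷ₛ (shift g) (shift f) f₁≡1) n) }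

  ·-cancelˡ-shift : ∀ f {x y} → f 0 ≡ 0ℚ → shift f 0 ≡ 1ℚ → f · x ≋ f · y → x ≋ y
  ·-cancelˡ-shift f {x} {y} f₀≡0 f₁≡1 fx≋fy = ·-cancelˡ-unit (shift f) f₁≡1 (coefficientwise λ n →
    trans (sym (shift-· f x f₀≡0 n)) (trans (coeff fx≋fy (suc n)) (shift-· f y f₀≡0 n)))

  sinh·polyCosecant : ∀ k → sinh · polyCosecantSeries k ≋ compose (A k) tanhHalf
  sinh·polyCosecant k = ·-shift-÷ₛ sinh (compose (A k) tanhHalf) refl refl refl

  polyCosecant-pred : ∀ k → polyCosecantSeries (k ℤ.- 1ℤ) ≋ ∂ (sinh · polyCosecantSeries k)
  polyCosecant-pred k = ·-cancelˡ-shift sinh refl refl (begin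
    sinh · polyCosecantSeries (k ℤ.- 1ℤ)         ≈⟨ sinh·polyCosecant (k ℤ.- 1ℤ) ⟩
    compose (A (k ℤ.- 1ℤ)) tanhHalf              ≈⟨ compose-cong tanhHalf (A-pred k) ⟩
    compose (λ j → ℕ→ℚ j * A k j) tanhHalf       ≈⟨ θ-compose sinh (A k) tanhHalf sinh·∂tanhHalf≋tanhHalf refl ⟨
    θ sinh (compose (A k) tanhHalf)              ≈⟨ θ-cong sinh (sinh·polyCosecant k) ⟨
    θ sinh (sinh · polyCosecantSeries k)         ∎)
    where open ≈-Reasoning

  -- Exponential coefficients

  egf : Series → ℕ → ℚ
  egf f n = ℕ→ℚ (n !) * f n

  egf-cong : ∀ {f g} → f ≋ g → ∀ n → egf f n ≡ egf g n
  egf-cong f≋g n = cong (ℕ→ℚ (n !) *_) (coeff f≋g n)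

  egf-∂ : ∀ f n → egf (∂ f) n ≡ egf f (suc n)
  egf-∂ f n = begin
    ℕ→ℚ (n !) * (ℕ→ℚ (suc n) * f (suc n))  ≡⟨ ℚ.*-assoc (ℕ→ℚ (n !)) (ℕ→ℚ (suc n)) (f (suc n)) ⟨
    ℕ→ℚ (n !) * ℕ→ℚ (suc n) * f (suc n)    ≡⟨ cong (_* f (suc n)) (trans (ℚ.*-comm (ℕ→ℚ (n !)) (ℕ→ℚ (suc n))) (sym (ℕ→ℚ-homo-* (suc n) (n !)))) ⟩
    ℕ→ℚ (suc n !) * f (suc n)              ∎
    where open ≡-Reasoning

  egf-sinh : ∀ n → egf sinh n ≡ odd? n
  egf-sinh n = begin
    ℕ→ℚ (n !) * (odd? n * inv! n)  ≡⟨ x∙yz≈y∙xz (ℕ→ℚ (n !)) (odd? n) (inv! n) ⟩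
    odd? n * (ℕ→ℚ (n !) * inv! n)  ≡⟨ cong (odd? n *_) (ℕ→ℚ-*-inverse (n !) {{n ℕ.!≢0}}) ⟩
    odd? n * 1ℚ                    ≡⟨ ℚ.*-identityʳ (odd? n) ⟩
    odd? n                         ∎
    where open ≡-Reasoning

  nCi*[i!*[n∸i]!]≡n! : ∀ {n i} → i ≤ n → (n C i) ℕ.* (i ! ℕ.* (n ∸ i) !) ≡ n !
  nCi*[i!*[n∸i]!]≡n! {n} {i} i≤n = trans (cong (ℕ._* (i ! ℕ.* (n ∸ i) !)) (nCk≡n!/k![n-k]! i≤n))
    (m/n*n≡m {{ℕ.m*n≢0 (i !) ((n ∸ i) !) {{i ℕ.!≢0}} {{(n ∸ i) ℕ.!≢0}}}} (k![n∸k]!∣n! i≤n))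

  egf-· : ∀ f g n → egf (f · g) n ≡ ∑ (suc n) (λ i → ℕ→ℚ (n C i) * (egf f i * egf g (n ∸ i)))
  egf-· f g n = begin
    ℕ→ℚ (n !) * (f · g) n                                       ≡⟨ cong (ℕ→ℚ (n !) *_) (·-coeff f g n) ⟩
    ℕ→ℚ (n !) * ∑ (suc n) (λ i → f i * g (n ∸ i))               ≡⟨ *-distribˡ-∑ (suc n) (ℕ→ℚ (n !)) (λ i → f i * g (n ∸ i)) ⟩
    ∑ (suc n) (λ i → ℕ→ℚ (n !) * (f i * g (n ∸ i)))             ≡⟨ ∑-cong (suc n) (λ i i≤n → binomial i (ℕ.≤-pred i≤n)) ⟩
    ∑ (suc n) (λ i → ℕ→ℚ (n C i) * (egf f i * egf g (n ∸ i)))   ∎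
    where
    open ≡-Reasoning
    open +-*-Solver
    binomial : ∀ i → i ≤ n → ℕ→ℚ (n !) * (f i * g (n ∸ i)) ≡ ℕ→ℚ (n C i) * (egf f i * egf g (n ∸ i))
    binomial i i≤n = begin
      ℕ→ℚ (n !) * (f i * g (n ∸ i))
        ≡⟨ cong (λ m → ℕ→ℚ m * (f i * g (n ∸ i))) (nCi*[i!*[n∸i]!]≡n! i≤n) ⟨
      ℕ→ℚ ((n C i) ℕ.* (i ! ℕ.* (n ∸ i) !)) * (f i * g (n ∸ i))
        ≡⟨ cong (_* (f i * g (n ∸ i))) (trans (ℕ→ℚ-homo-* (n C i) (i ! ℕ.* (n ∸ i) !)) (cong (ℕ→ℚ (n C i) *_) (ℕ→ℚ-homo-* (i !) ((n ∸ i) !)))) ⟩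
      ℕ→ℚ (n C i) * (ℕ→ℚ (i !) * ℕ→ℚ ((n ∸ i) !)) * (f i * g (n ∸ i))
        ≡⟨ solve 5 (λ c a b x y → c :* (a :* b) :* (x :* y) := c :* ((a :* x) :* (b :* y))) refl
                   (ℕ→ℚ (n C i)) (ℕ→ℚ (i !)) (ℕ→ℚ ((n ∸ i) !)) (f i) (g (n ∸ i)) ⟩
      ℕ→ℚ (n C i) * (egf f i * egf g (n ∸ i)) ∎

  egf-sinh-· : ∀ f n → egf (sinh · f) n ≡ ∑ (suc n) (λ i → odd? i * (ℕ→ℚ (n C i) * egf f (n ∸ i)))
  egf-sinh-· f n = trans (egf-· sinh f n) (∑-cong (suc n) λ i _ →
    trans (cong (λ e → ℕ→ℚ (n C i) * (e * egf f (n ∸ i))) (egf-sinh i)) (x∙yz≈y∙xz (ℕ→ℚ (n C i)) (odd? i) (egf f (n ∸ i))))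

  0*a+[1*b+c]≡b+c : ∀ a b c → 0ℚ * a + (1ℚ * b + c) ≡ b + c
  0*a+[1*b+c]≡b+c a b c = trans (cong₂ _+_ (ℚ.*-zeroˡ a) (cong (_+ c) (ℚ.*-identityˡ b))) (ℚ.+-identityˡ (b + c))

  ∑-odd : ∀ n (f : ℕ → ℚ) → ∑ (2 ℕ.+ n) (λ i → odd? i * f i) ≡ ∑ (suc ⌊ n /2⌋) (λ m → f (2 ℕ.* m ℕ.+ 1))
  ∑-odd zero                f = 0*a+[1*b+c]≡b+c (f 0) (f 1) 0ℚ
  ∑-odd (suc zero)          f = trans (0*a+[1*b+c]≡b+c (f 0) (f 1) (0ℚ * f 2 + 0ℚ))
                                      (cong (f 1 +_) (trans (ℚ.+-identityʳ (0ℚ * f 2)) (ℚ.*-zeroˡ (f 2))))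
  ∑-odd (suc (suc n))       f = begin
    0ℚ * f 0 + (1ℚ * f 1 + ∑ (2 ℕ.+ n) (λ i → odd? i * f (2 ℕ.+ i)))
      ≡⟨ 0*a+[1*b+c]≡b+c (f 0) (f 1) (∑ (2 ℕ.+ n) (λ i → odd? i * f (2 ℕ.+ i))) ⟩
    f 1 + ∑ (2 ℕ.+ n) (λ i → odd? i * f (2 ℕ.+ i))
      ≡⟨ cong (f 1 +_) (∑-odd n (λ i → f (2 ℕ.+ i))) ⟩
    f 1 + ∑ (suc ⌊ n /2⌋) (λ m → f (2 ℕ.+ (2 ℕ.* m ℕ.+ 1)))
      ≡⟨ cong (f 1 +_) (∑-cong (suc ⌊ n /2⌋) (λ m _ → cong f (sym (trans (cong (ℕ._+ 1) (ℕ.*-suc 2 m)) (ℕ.+-assoc 2 (2 ℕ.* m) 1))))) ⟩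
    f 1 + ∑ (suc ⌊ n /2⌋) (λ m → f (2 ℕ.* suc m ℕ.+ 1))
      ∎
    where open ≡-Reasoning


open import Data.Nat using (ℕ; _+_; _*_; _∸_; ⌊_/2⌋)
open import Data.Nat.Combinatorics using (_C_)
open import Data.Integer using (ℤ; _-_; +_)
open import Data.Rational using (ℚ) renaming (_*_ to _*ℚ_)
open import Relation.Binary.PropositionalEquality using (_≡_)
open import Data.Nat.Properties using (+-comm)
open import Relation.Binary.PropositionalEquality using (cong₂; module ≡-Reasoning)

proposition2p1 : (k : ℤ) (n : ℕ) →
    D (k - + 1) n ≡ Σ≤ ⌊ n /2⌋ (λ m → ℕ→ℚ ((n + 1) C (2 * m + 1)) *ℚ D k (n ∸ 2 * m))
proposition2p1 k n = begin
  D (k - + 1) n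
    ≡⟨ egf-cong (polyCosecant-pred k) n ⟩
  egf (∂ (sinh · polyCosecantSeries k)) n
    ≡⟨ egf-∂ (sinh · polyCosecantSeries k) n ⟩
  egf (sinh · polyCosecantSeries k) (1 + n)
    ≡⟨ egf-sinh-· (polyCosecantSeries k) (1 + n) ⟩
  ∑ (2 + n) (λ i → odd? i *ℚ (ℕ→ℚ ((1 + n) C i) *ℚ D k (1 + n ∸ i)))
    ≡⟨ ∑-odd n (λ i → ℕ→ℚ ((1 + n) C i) *ℚ D k (1 + n ∸ i)) ⟩
  ∑ (1 + ⌊ n /2⌋) (λ m → ℕ→ℚ ((1 + n) C (2 * m + 1)) *ℚ D k (1 + n ∸ (2 * m + 1)))
    ≡⟨ ∑-cong (1 + ⌊ n /2⌋) (λ m _ → cong₂ (λ a b → ℕ→ℚ (a C (2 * m + 1)) *ℚ D k (1 + n ∸ b)) (+-comm 1 n) (+-comm (2 * m) 1)) ⟩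
  ∑ (1 + ⌊ n /2⌋) (λ m → ℕ→ℚ ((n + 1) C (2 * m + 1)) *ℚ D k (n ∸ 2 * m))
    ≡⟨ Σ≤≡∑ ⌊ n /2⌋ (λ m → ℕ→ℚ ((n + 1) C (2 * m + 1)) *ℚ D k (n ∸ 2 * m)) ⟨
  Σ≤ ⌊ n /2⌋ (λ m → ℕ→ℚ ((n + 1) C (2 * m + 1)) *ℚ D k (n ∸ 2 * m))
    ∎
  where open ≡-Reasoning
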